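{- Let $G=(V,E)$ be a DAG with topological order $v_1,\ldots,v_{|V|}$, and for $t\in\{0,\ldots,|V|\}$ let $G_t=G[\{v_1,\ldots,v_t\}]$ and let $S_t$ be the support of $G_t$. Let $1\le i\le j\le |V|$. If $v_i\in S_j$, then $v_i\in S_t$ for all $t\in\{i,\ldots,j\}$.
   Context: A topological order is an ordering of the vertices such that every edge goes from an earlier to a later vertex; $G_0$ is the empty graph. In a directed graph $H$, $u$ reaches $v$ if there is a path (sequence of distinct vertices, consecutive ones joined by edges of $H$, at least one vertex) from $u$ to $v$ in $H$. An antichain of $H$ is a set of vertices no one of which reaches a different one in $H$. A set $A$ reaches $v$ if some $u\in A$ reaches $v$. For antichains $A,B$ of $H$ of the same size, $B$ dominates $A$ (in $H$) if for every $b\in B$, $A$ reaches $b$ in $H$; antichains of different sizes are not related. An $H$-frontier antichain is an antichain of $H$ not dominated in $H$ by any other antichain of $H$. The support $S_t$ of $G_t$ is the union of all $G_t$-frontier antichains. -}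

module Defs where

open import Data.Nat using (ℕ; _<_; _≤_)
open import Data.Fin using (Fin; toℕ)
open import Data.Fin.Subset using (Subset; _∈_; ∣_∣)
open import Data.List using (List; []; _∷_; last)
open import Data.List.Relation.Unary.All using (All)
open import Data.List.Relation.Unary.Unique.Propositional using (Unique)
open import Data.Maybe using (just)
open import Data.Product using (Σ; ∃; _×_)
open import Relation.Binary.PropositionalEquality using (_≡_; _≢_)
open import Relation.Nullary using (¬_)

-- A directed graph on the vertex set Fin n: vertex k (0-based) is v_{k+1}
-- of the paper's topological order.
Graph : ℕ → Set₁
Graph n = Fin n → Fin n → Set

-- The identity order v_1,...,v_n (i.e. Fin order) is a topological order of E.
IsTopOrder : {n : ℕ} → Graph n → Set
IsTopOrder {n} E = (u v : Fin n) → E u v → toℕ u < toℕ v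

-- G_t = G[{v_1,...,v_t}]: vertices with 0-based index < t.
InG : {n : ℕ} → ℕ → Fin n → Set
InG t v = toℕ v < t

Chain : {n : ℕ} → Graph n → List (Fin n) → Set
Chain E []           = Data.Unit.⊤ where import Data.Unit
Chain E (x ∷ [])     = Data.Unit.⊤ where import Data.Unit
Chain E (x ∷ y ∷ xs) = E x y × Chain E (y ∷ xs)

record Path {n : ℕ} (E : Graph n) (t : ℕ) (u v : Fin n) : Set where
  field
    rest     : List (Fin n)
    lastV    : last (u ∷ rest) ≡ just v
    inG      : All (InG t) (u ∷ rest)
    distinct : Unique (u ∷ rest)
    edges    : Chain E (u ∷ rest)

Reaches : {n : ℕ} → Graph n → ℕ → Fin n → Fin n → Set
Reaches E t u v = Path E t u v

IsAntichain : {n : ℕ} → Graph n → ℕ → Subset n → Set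
IsAntichain {n} E t A =
  ((v : Fin n) → v ∈ A → InG t v) ×
  ((u v : Fin n) → u ∈ A → v ∈ A → u ≢ v → ¬ Reaches E t u v)

SetReaches : {n : ℕ} → Graph n → ℕ → Subset n → Fin n → Set
SetReaches {n} E t A v = Σ (Fin n) (λ u → u ∈ A × Reaches E t u v)

Dominates : {n : ℕ} → Graph n → ℕ → Subset n → Subset n → Set
Dominates {n} E t B A = (∣ B ∣ ≡ ∣ A ∣) × ((b : Fin n) → b ∈ B → SetReaches E t A b)

IsFrontier : {n : ℕ} → Graph n → ℕ → Subset n → Set
IsFrontier {n} E t A =
  IsAntichain E t A ×
  ((B : Subset n) → IsAntichain E t B → B ≢ A → ¬ Dominates E t B A)

InSupport : {n : ℕ} → Graph n → ℕ → Fin n → Set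
InSupport {n} E t v = Σ (Subset n) (λ A → IsFrontier E t A × v ∈ A)

-- Induct on j − t: it suffices to pass from G_{k+1} to G_k when k > i, i.e. to delete the
-- last vertex w.  Because the order is topological, every walk is a path, reachability in
-- G_{k+1} between vertices of G_k is already reachability in G_k, and w reaches only itself.
-- A frontier antichain A ∋ v_i of G_{k+1} avoiding w therefore stays frontier in G_k.  If
-- w ∈ A, then A − w is frontier in G_k: an antichain B of G_k dominating A − w yields the
-- antichain B + w of G_{k+1} dominating A (a vertex of B reaching w would make some vertex
-- of A − w reach w), contradicting the frontier property of A.
module Submission where

open import Defs
open import Data.Bool using (true; false)
open import Data.Bool.Properties using (¬-not)
open import Data.Nat using (ℕ; suc; _<_; _≤_; _≤′_; ≤′-refl; ≤′-step)
open import Data.Nat.Properties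
  using ( ≤-refl; ≤-reflexive; ≤-trans; ≤-pred; <⇒≤; <⇒≢; <⇒≱; <-≤-trans
        ; m≤n⇒m≤1+n; n≤1+n; ≤∧≢⇒<; ≤⇒≤′; ≤′⇒≤ )
open import Data.Fin as Fin using (Fin; toℕ)
open import Data.Fin.Properties using (toℕ-injective; toℕ-fromℕ<; _≟_)
open import Data.Fin.Subset using (Subset; _∈_; _∉_; _⊆_; ∣_∣; inside; outside)
open import Data.Fin.Subset.Properties using (_∈?_)
open import Data.Vec using (_∷_; _[_]≔_)
open import Data.Vec.Properties
  using ([]≔-updates; []≔-lookup; []≔-idempotent; lookup∘updateAt′; []=⇒lookup; lookup⇒[]=; []=-injective)
open import Data.List using ([]; _∷_; last)
open import Data.List.Relation.Unary.All as All using (All; []; _∷_)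
open import Data.List.Relation.Unary.AllPairs using ([]; _∷_)
open import Data.Maybe using (just)
open import Data.Product using (_,_; proj₁; proj₂)
open import Data.Unit using (tt)
open import Function using (_∘_)
open import Relation.Binary.PropositionalEquality
  using (_≡_; _≢_; refl; sym; trans; cong; subst; module ≡-Reasoning)
open import Relation.Nullary using (¬_; yes; no)

module _ {n : ℕ} {x y : Fin n} {p : Subset n} where

  x∈p[y]≔b⁻ : ∀ {b} → x ≢ y → x ∈ p [ y ]≔ b → x ∈ p
  x∈p[y]≔b⁻ x≢y x∈ = lookup⇒[]= x p (trans (sym (lookup∘updateAt′ x y x≢y p)) ([]=⇒lookup x∈))

  x∈p[y]≔b⁺ : ∀ {b} → x ≢ y → x ∈ p → x ∈ p [ y ]≔ b
  x∈p[y]≔b⁺ x≢y x∈ = lookup⇒[]= x _ (trans (lookup∘updateAt′ x y x≢y p) ([]=⇒lookup x∈))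

x∉p[x]≔outside : ∀ {n} (x : Fin n) (p : Subset n) → x ∉ p [ x ]≔ outside
x∉p[x]≔outside x p x∈ with []=-injective x∈ ([]≔-updates p x)
... | ()

x∈p[y]≔outside⇒x≢y : ∀ {n} {x y : Fin n} {p : Subset n} → x ∈ p [ y ]≔ outside → x ≢ y
x∈p[y]≔outside⇒x≢y {x = x} {p = p} x∈ refl = x∉p[x]≔outside x p x∈

p[x]≔outside⊆p : ∀ {n} {x : Fin n} {p : Subset n} → p [ x ]≔ outside ⊆ p
p[x]≔outside⊆p y∈ = x∈p[y]≔b⁻ (x∈p[y]≔outside⇒x≢y y∈) y∈

x∈p⇒p[x]≔inside≡p : ∀ {n} {x : Fin n} {p : Subset n} → x ∈ p → p [ x ]≔ inside ≡ p
x∈p⇒p[x]≔inside≡p {x = x} {p} x∈p = trans (cong (p [ x ]≔_) (sym ([]=⇒lookup x∈p))) ([]≔-lookup p x)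

x∉p⇒p[x]≔outside≡p : ∀ {n} {x : Fin n} {p : Subset n} → x ∉ p → p [ x ]≔ outside ≡ p
x∉p⇒p[x]≔outside≡p {x = x} {p} x∉p =
  trans (cong (p [ x ]≔_) (sym (¬-not (x∉p ∘ lookup⇒[]= x p)))) ([]≔-lookup p x)

∣p[x]≔inside∣≡1+∣p[x]≔outside∣ : ∀ {n} (x : Fin n) (p : Subset n) →
                                 ∣ p [ x ]≔ inside ∣ ≡ suc ∣ p [ x ]≔ outside ∣
∣p[x]≔inside∣≡1+∣p[x]≔outside∣ Fin.zero    (_     ∷ p) = refl
∣p[x]≔inside∣≡1+∣p[x]≔outside∣ (Fin.suc x) (true  ∷ p) = cong suc (∣p[x]≔inside∣≡1+∣p[x]≔outside∣ x p)
∣p[x]≔inside∣≡1+∣p[x]≔outside∣ (Fin.suc x) (false ∷ p) = ∣p[x]≔inside∣≡1+∣p[x]≔outside∣ x p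

module _ {n : ℕ} (E : Graph n) where

  data Walk (t : ℕ) : Fin n → Fin n → Set where
    stay : ∀ {u} → InG t u → Walk t u u
    step : ∀ {u v w} → InG t u → E u v → Walk t v w → Walk t u w

  walk-++ : ∀ {t a b c} → Walk t a b → Walk t b c → Walk t a c
  walk-++ (stay _)     q = q
  walk-++ (step p e r) q = step p e (walk-++ r q)

  chain⇒walk : ∀ {t u v} rest → last (u ∷ rest) ≡ just v →
               All (InG t) (u ∷ rest) → Chain E (u ∷ rest) → Walk t u v
  chain⇒walk []       refl (p ∷ [])  _       = stay p
  chain⇒walk (_ ∷ xs) eq   (p ∷ ps) (e , c) = step p e (chain⇒walk xs eq ps c)

  path⇒walk : ∀ {t u v} → Path E t u v → Walk t u v
  path⇒walk P = chain⇒walk (Path.rest P) (Path.lastV P) (Path.inG P) (Path.edges P)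

  reaches-refl : ∀ {t u} → InG t u → Reaches E t u u
  reaches-refl p = record { rest = [] ; lastV = refl ; inG = p ∷ [] ; distinct = [] ∷ [] ; edges = tt }

  reaches-weaken : ∀ {s t u v} → s ≤ t → Reaches E s u v → Reaches E t u v
  reaches-weaken s≤t P = record
    { rest     = Path.rest P
    ; lastV    = Path.lastV P
    ; inG      = All.map (λ p → <-≤-trans p s≤t) (Path.inG P)
    ; distinct = Path.distinct P
    ; edges    = Path.edges P
    }

  module _ (top : IsTopOrder E) where

    walk-ascending : ∀ {t a b} → Walk t a b → toℕ a ≤ toℕ b
    walk-ascending (stay _)     = ≤-refl
    walk-ascending (step _ e r) = ≤-trans (<⇒≤ (top _ _ e)) (walk-ascending r)

    walk-restrict : ∀ {s t a b} → Walk t a b → InG s b → Walk s a b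
    walk-restrict (stay _)     q = stay q
    walk-restrict (step _ e r) q =
      step (<-≤-trans (top _ _ e) (≤-trans (walk-ascending r) (<⇒≤ q))) e (walk-restrict r q)

    chain-ascending : ∀ {v} xs → Chain E (v ∷ xs) → All (λ x → toℕ v ≤ toℕ x) (v ∷ xs)
    chain-ascending []       _       = ≤-refl ∷ []
    chain-ascending (_ ∷ xs) (e , c) =
      ≤-refl ∷ All.map (≤-trans (<⇒≤ (top _ _ e))) (chain-ascending xs c)

    path-∷ : ∀ {t u v w} → InG t u → E u v → Path E t v w → Path E t u w
    path-∷ p e P = record
      { rest     = _ ∷ Path.rest P
      ; lastV    = Path.lastV P
      ; inG      = p ∷ Path.inG P
      ; distinct = All.map (λ v≤x → <⇒≢ (<-≤-trans (top _ _ e) v≤x) ∘ cong toℕ)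
                           (chain-ascending (Path.rest P) (Path.edges P))
                   ∷ Path.distinct P
      ; edges    = e , Path.edges P
      }

    walk⇒path : ∀ {t u v} → Walk t u v → Path E t u v
    walk⇒path (stay p)     = reaches-refl p
    walk⇒path (step p e r) = path-∷ p e (walk⇒path r)

    reaches-ascending : ∀ {t u v} → Reaches E t u v → toℕ u ≤ toℕ v
    reaches-ascending = walk-ascending ∘ path⇒walk

    reaches-trans : ∀ {t a b c} → Reaches E t a b → Reaches E t b c → Reaches E t a c
    reaches-trans P Q = walk⇒path (walk-++ (path⇒walk P) (path⇒walk Q))

    reaches-restrict : ∀ {s t u v} → Reaches E t u v → InG s v → Reaches E s u v
    reaches-restrict P q = walk⇒path (walk-restrict (path⇒walk P) q)

    antichain-⊆ : ∀ {t A B} → B ⊆ A → IsAntichain E t A → IsAntichain E t B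
    antichain-⊆ B⊆A (inG , indep) =
      (λ v → inG v ∘ B⊆A) , (λ u v u∈B v∈B → indep u v (B⊆A u∈B) (B⊆A v∈B))

    antichain-shrink : ∀ {s t A} → s ≤ t → IsAntichain E t A →
                       (∀ v → v ∈ A → InG s v) → IsAntichain E s A
    antichain-shrink s≤t (_ , indep) inG =
      inG , (λ u v u∈A v∈A u≢v → indep u v u∈A v∈A u≢v ∘ reaches-weaken s≤t)

    antichain-grow : ∀ {s t A} → s ≤ t → IsAntichain E s A → IsAntichain E t A
    antichain-grow s≤t (inG , indep) =
      (λ v v∈A → <-≤-trans (inG v v∈A) s≤t) ,
      (λ u v u∈A v∈A u≢v P → indep u v u∈A v∈A u≢v (reaches-restrict P (inG v v∈A)))

    dominates-weaken : ∀ {s t A B} → s ≤ t → Dominates E s B A → Dominates E t B A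
    dominates-weaken s≤t (size , dom) = size , λ b b∈B → reach (dom b b∈B)
      where
      reach : ∀ {A b} → SetReaches E _ A b → SetReaches E _ A b
      reach (a , a∈A , P) = a , a∈A , reaches-weaken s≤t P

    frontier-shrink : ∀ {s t A} → s ≤ t → IsFrontier E t A →
                      (∀ v → v ∈ A → InG s v) → IsFrontier E s A
    frontier-shrink s≤t (anti , maximal) inG =
      antichain-shrink s≤t anti inG ,
      λ B antiB B≢A → maximal B (antichain-grow s≤t antiB) B≢A ∘ dominates-weaken s≤t

    module _ {k : ℕ} {w : Fin n} (w≡k : toℕ w ≡ k) where

      last∈G : InG (suc k) w
      last∈G = ≤-reflexive (cong suc w≡k)

      below-last : ∀ {v} → InG (suc k) v → v ≢ w → InG k v
      below-last v<1+k v≢w = ≤∧≢⇒< (≤-pred v<1+k) (v≢w ∘ toℕ-injective ∘ λ v≡k → trans v≡k (sym w≡k))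

      last∉G : ∀ {B} → (∀ v → v ∈ B → InG k v) → w ∉ B
      last∉G inG w∈B = <⇒≢ (inG w w∈B) w≡k

      antichain-add-last : ∀ {A B} → IsAntichain E (suc k) A → w ∈ A →
                           IsAntichain E k B → Dominates E k B (A [ w ]≔ outside) →
                           IsAntichain E (suc k) (B [ w ]≔ inside)
      antichain-add-last {B = B} (_ , indepA) w∈A antiB@(inG , _) (_ , dom) = inG′ , indep′
        where
        inG′ : ∀ v → v ∈ B [ w ]≔ inside → InG (suc k) v
        inG′ v v∈ with v ≟ w
        ... | yes refl = last∈G
        ... | no v≢w   = m≤n⇒m≤1+n (inG v (x∈p[y]≔b⁻ v≢w v∈))
        indep′ : ∀ u v → u ∈ B [ w ]≔ inside → v ∈ B [ w ]≔ inside → u ≢ v → ¬ Reaches E (suc k) u v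
        indep′ u v u∈ v∈ u≢v P with u ≟ w | v ≟ w
        ... | yes refl | _ =
          <⇒≱ (inG v (x∈p[y]≔b⁻ (u≢v ∘ sym) v∈)) (subst (_≤ toℕ v) w≡k (reaches-ascending P))
        ... | no u≢w | no v≢w =
          proj₂ (antichain-grow (n≤1+n k) antiB) u v (x∈p[y]≔b⁻ u≢w u∈) (x∈p[y]≔b⁻ v≢w v∈) u≢v P
        ... | no u≢w | yes refl with dom u (x∈p[y]≔b⁻ u≢w u∈)
        ...   | a , a∈A′ , Q =
          indepA a w (p[x]≔outside⊆p a∈A′) w∈A (x∈p[y]≔outside⇒x≢y a∈A′)
                 (reaches-trans (reaches-weaken (n≤1+n k) Q) P)

      dominates-add-last : ∀ {A B} → w ∈ A → w ∉ B → Dominates E k B (A [ w ]≔ outside) →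
                           Dominates E (suc k) (B [ w ]≔ inside) A
      dominates-add-last {A} {B} w∈A w∉B (size , dom) = size′ , dom′
        where
        open ≡-Reasoning
        size′ : ∣ B [ w ]≔ inside ∣ ≡ ∣ A ∣
        size′ = begin
          ∣ B [ w ]≔ inside ∣        ≡⟨ ∣p[x]≔inside∣≡1+∣p[x]≔outside∣ w B ⟩
          suc ∣ B [ w ]≔ outside ∣   ≡⟨ cong (suc ∘ ∣_∣) (x∉p⇒p[x]≔outside≡p w∉B) ⟩
          suc ∣ B ∣                  ≡⟨ cong suc size ⟩
          suc ∣ A [ w ]≔ outside ∣   ≡⟨ ∣p[x]≔inside∣≡1+∣p[x]≔outside∣ w A ⟨
          ∣ A [ w ]≔ inside ∣        ≡⟨ cong ∣_∣ (x∈p⇒p[x]≔inside≡p w∈A) ⟩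
          ∣ A ∣                      ∎
        dom′ : ∀ b → b ∈ B [ w ]≔ inside → SetReaches E (suc k) A b
        dom′ b b∈ with b ≟ w
        ... | yes refl = w , w∈A , reaches-refl last∈G
        ... | no b≢w with dom b (x∈p[y]≔b⁻ b≢w b∈)
        ...   | a , a∈A′ , P = a , p[x]≔outside⊆p a∈A′ , reaches-weaken (n≤1+n k) P

      frontier-remove-last : ∀ {A} → IsFrontier E (suc k) A → w ∈ A →
                             IsFrontier E k (A [ w ]≔ outside)
      frontier-remove-last {A} (antiA , maximal) w∈A = antiA′ , maximal′
        where
        antiA′ : IsAntichain E k (A [ w ]≔ outside)
        antiA′ = antichain-shrink (n≤1+n k) (antichain-⊆ p[x]≔outside⊆p antiA)
          λ v v∈ → below-last (proj₁ antiA v (p[x]≔outside⊆p v∈)) (x∈p[y]≔outside⇒x≢y v∈)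
        maximal′ : ∀ B → IsAntichain E k B → B ≢ A [ w ]≔ outside →
                   ¬ Dominates E k B (A [ w ]≔ outside)
        maximal′ B antiB B≢A′ domB =
          maximal (B [ w ]≔ inside) (antichain-add-last antiA w∈A antiB domB) B′≢A
                  (dominates-add-last w∈A w∉B domB)
          where
          open ≡-Reasoning
          w∉B : w ∉ B
          w∉B = last∉G (proj₁ antiB)
          B′≢A : B [ w ]≔ inside ≢ A
          B′≢A B′≡A = B≢A′ (begin
            B                               ≡⟨ x∉p⇒p[x]≔outside≡p w∉B ⟨
            B [ w ]≔ outside                ≡⟨ []≔-idempotent B w ⟨
            B [ w ]≔ inside [ w ]≔ outside  ≡⟨ cong (_[ w ]≔ outside) B′≡A ⟩
            A [ w ]≔ outside                ∎)

      support-remove-last : ∀ {i} → toℕ i < k → InSupport E (suc k) i → InSupport E k i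
      support-remove-last {i} i<k (A , frontier , i∈A) with w ∈? A
      ... | no w∉A =
        A , frontier-shrink (n≤1+n k) frontier inG , i∈A
        where
        inG : ∀ v → v ∈ A → InG k v
        inG v v∈A = below-last (proj₁ (proj₁ frontier) v v∈A) λ { refl → w∉A v∈A }
      ... | yes w∈A =
        A [ w ]≔ outside , frontier-remove-last frontier w∈A , x∈p[y]≔b⁺ i≢w i∈A
        where
        i≢w : i ≢ w
        i≢w i≡w = <⇒≢ i<k (trans (cong toℕ i≡w) w≡k)

    support-descend : ∀ {i t j} → t ≤′ j → j ≤ n → toℕ i < t → InSupport E j i → InSupport E t i
    support-descend ≤′-refl _ _ S = S
    support-descend {j = suc k} (≤′-step t≤′k) k<n i<t S =
      support-descend t≤′k (<⇒≤ k<n) i<t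
        (support-remove-last (toℕ-fromℕ< k<n) (<-≤-trans i<t (≤′⇒≤ t≤′k)) S)

lemma8 : (n : ℕ) (E : Graph n) → IsTopOrder E →
         (i : Fin n) (j : ℕ) → toℕ i < j → j ≤ n →
         InSupport E j i →
         (t : ℕ) → toℕ i < t → t ≤ j → InSupport E t i
lemma8 n E top i j _ j≤n S t i<t t≤j = support-descend E top (≤⇒≤′ t≤j) j≤n i<t S
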